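{- Fix $k\ge2$ and let $\pi$ be a permutation containing a decreasing subsequence of length $k$, with A-sequence $a_k\cdots a_1$. Then $a_k$ is the leftmost letter of $\pi$ with label $k$, and for $i<k$, $a_i$ is the first letter after $a_{i+1}$ that has label $i$. In particular, the A-sequence of $\pi$ is the successor sequence of $a_k$, and the labels associated to $a_k,a_{k-1},\ldots,a_1$ are $k,k-1,\ldots,1$.
   Context: Letters of $\pi$ are identified with their values. The A-sequence of $\pi$ is its lexicographically smallest (as a sequence of values read left to right) decreasing subsequence of length $k$. The label $\ell(x)$ of a letter $x$ of $\pi$ is the maximal length of a decreasing subsequence of $\pi$ starting at $x$. The successor sequence of a letter $x$ with $\ell(x)=m$ is the sequence $s_m s_{m-1}\cdots s_1$ with $s_m=x$ and, for $i\le m$, $s_{i-1}$ the leftmost letter after $s_i$ with $\ell(s_{i-1})=\ell(s_i)-1$. -}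

module Defs where

open import Data.Nat using (ℕ; zero; suc; _∸_; _≤_)
open import Data.Fin using (Fin; toℕ; _<_) renaming (pred to predF; zero to fzero)
open import Data.Product using (Σ; ∃; _×_; _,_)
open import Data.Sum using (_⊎_)
open import Relation.Nullary using (¬_)
open import Relation.Binary.PropositionalEquality using (_≡_)
open import Function.Definitions using (Injective)

-- A permutation of n letters: position (Fin n) ↦ value (Fin n), injective.
-- Letters are identified with their values; we refer to a letter by its
-- position, which determines it uniquely.
IsPerm : {n : ℕ} → (Fin n → Fin n) → Set
IsPerm π = Injective _≡_ _≡_ π

-- A subsequence of length m is given by its positions s : Fin m → Fin n,
-- index 0 being the leftmost entry.  It is decreasing if positions strictly
-- increase and values strictly decrease.
IsDecSubseq : {n m : ℕ} → (Fin n → Fin n) → (Fin m → Fin n) → Set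
IsDecSubseq π s = ∀ i j → i < j → (s i < s j) × (π (s j) < π (s i))

LexLt : {n m : ℕ} → (Fin n → Fin n) → (Fin m → Fin n) → (Fin m → Fin n) → Set
LexLt π s t = ∃ λ j → (∀ i → i < j → π (s i) ≡ π (t i)) × (π (s j) < π (t j))

LexLe : {n m : ℕ} → (Fin n → Fin n) → (Fin m → Fin n) → (Fin m → Fin n) → Set
LexLe π s t = LexLt π s t ⊎ (∀ i → π (s i) ≡ π (t i))

IsASeq : {n : ℕ} → (k : ℕ) → (Fin n → Fin n) → (Fin k → Fin n) → Set
IsASeq {n} k π a = IsDecSubseq π a × (∀ (b : Fin k → Fin n) → IsDecSubseq π b → LexLe π a b)

Label : {n : ℕ} → (Fin n → Fin n) → Fin n → ℕ → Set
Label {n} π p m =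
  (Σ ℕ λ m' → (m ≡ suc m') × ∃ λ (s : Fin (suc m') → Fin n) → IsDecSubseq π s × (s fzero ≡ p))
  × (∀ m' (s : Fin (suc m') → Fin n) → IsDecSubseq π s → s fzero ≡ p → suc m' ≤ m)

LeftmostWithLabel : {n : ℕ} → (Fin n → Fin n) → Fin n → ℕ → Set
LeftmostWithLabel π q m = Label π q m × (∀ r → r < q → ¬ Label π r m)

FirstAfterWithLabel : {n : ℕ} → (Fin n → Fin n) → Fin n → Fin n → ℕ → Set
FirstAfterWithLabel π p q m = (p < q) × Label π q m × (∀ r → p < r → r < q → ¬ Label π r m)

-- t (length m, index 0 leftmost, t j playing the role of s_{m-j}) is the
-- successor sequence of the letter at position x, where ℓ(x) = m.
IsSuccSeq : {n m : ℕ} → (Fin n → Fin n) → Fin n → (Fin m → Fin n) → Set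
IsSuccSeq {n} {m} π x t =
  Label π x m
  × (∀ (j : Fin m) → toℕ j ≡ 0 → t j ≡ x)
  × (∀ (j : Fin m) → 1 ≤ toℕ j → FirstAfterWithLabel π (t (predF j)) (t j) (m ∸ toℕ j))

-- Write the A-sequence as a₀ ⋯ a_{k-1}, leftmost first.  If a decreasing
-- subsequence c of length at least k − j started after a_{j-1} with a value
-- below a_j, then a₀ ⋯ a_{j-1} followed by c, cut to length k, would be a
-- lexicographically smaller decreasing subsequence of length k.  Applied to
-- the tail of a decreasing subsequence starting at a_j, this bounds ℓ(a_j) by
-- k − j, and the suffix a_j ⋯ a_{k-1} attains it.  Applied to a letter r
-- strictly between a_{j-1} and a_j with label k − j, it gives π r ≥ π a_j;
-- equality is excluded by injectivity, and π r > π a_j is impossible since r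
-- could then be prepended to a_j ⋯ a_{k-1}.
module Submission where

open import Defs
open import Data.Nat using (ℕ; _≤_; _∸_)
open import Data.Fin using (Fin; toℕ) renaming (pred to predF)
open import Data.Product using (_×_)
open import Relation.Binary.PropositionalEquality using (_≡_)

open import Data.Nat as ℕ using (zero; suc; _+_; z≤n; s≤s)
import Data.Nat.Properties as ℕₚ
open import Data.Fin as Fin using (fromℕ<; inject₁) renaming (zero to fzero; suc to fsuc)
import Data.Fin.Properties as Finₚ
open import Data.Vec.Functional using (_∷_; tail)
open import Data.Product using (_,_; proj₁; proj₂)
open import Data.Sum using (inj₁; inj₂)
open import Function using (_∘_)
open import Relation.Nullary using (¬_; yes; no; contradiction)
open import Relation.Binary.PropositionalEquality using (refl; sym; trans; cong; subst; subst₂)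
open import Relation.Binary.Definitions using (tri<; tri≈; tri>)

module _ {n : ℕ} (π : Fin n → Fin n) where

  IsDecSubseq-≤ : ∀ {m} {s : Fin m → Fin n} → IsDecSubseq π s →
                  ∀ {i j} → i Fin.≤ j → (s i Fin.≤ s j) × (π (s j) Fin.≤ π (s i))
  IsDecSubseq-≤ s-dec {i} {j} i≤j with ℕₚ.m≤n⇒m<n∨m≡n i≤j
  ... | inj₁ i<j = ℕₚ.<⇒≤ (proj₁ (s-dec i j i<j)) , ℕₚ.<⇒≤ (proj₂ (s-dec i j i<j))
  ... | inj₂ i≡j rewrite Finₚ.toℕ-injective i≡j = ℕₚ.≤-refl , ℕₚ.≤-refl

  IsDecSubseq-∘ : ∀ {m m′} {s : Fin m → Fin n} (f : Fin m′ → Fin m) →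
                  (∀ {i j} → i Fin.< j → f i Fin.< f j) →
                  IsDecSubseq π s → IsDecSubseq π (s ∘ f)
  IsDecSubseq-∘ f f-mono s-dec i j i<j = s-dec (f i) (f j) (f-mono i<j)

  IsDecSubseq-∷ : ∀ {m} {x : Fin n} {s : Fin (suc m) → Fin n} →
                  x Fin.< s fzero → π (s fzero) Fin.< π x →
                  IsDecSubseq π s → IsDecSubseq π (x ∷ s)
  IsDecSubseq-∷ x<s₀ πs₀<πx s-dec fzero (fsuc j) _ =
    ℕₚ.<-≤-trans x<s₀ (proj₁ head≤) , ℕₚ.≤-<-trans (proj₂ head≤) πs₀<πx
    where head≤ = IsDecSubseq-≤ s-dec {fzero} {j} z≤n
  IsDecSubseq-∷ x<s₀ πs₀<πx s-dec (fsuc i) (fsuc j) (s≤s i<j) = s-dec i j i<j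

  LexLt⇒¬LexLe : ∀ {m} {s t : Fin m → Fin n} → LexLt π s t → ¬ LexLe π t s
  LexLt⇒¬LexLe (j , _ , lt) (inj₂ eq) = ℕₚ.<-irrefl (cong toℕ (sym (eq j))) lt
  LexLt⇒¬LexLe (j , eq , lt) (inj₁ (j′ , eq′ , lt′)) with Finₚ.<-cmp j j′
  ... | tri< j<j′ _ _ = ℕₚ.<-irrefl (cong toℕ (sym (eq′ j j<j′))) lt
  ... | tri≈ _ refl _ = ℕₚ.<-asym lt lt′
  ... | tri> _ _ j′<j = ℕₚ.<-irrefl (cong toℕ (sym (eq j′ j′<j))) lt′

module Splice {n k m : ℕ} (π : Fin n → Fin n) (a : Fin k → Fin n) (j : Fin k)
              (c : Fin (suc m) → Fin n) (k≤j+len : k ≤ toℕ j + suc m) where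

  private
    offset : Fin k → Fin (suc m)
    offset i = fromℕ< (ℕₚ.m<n+o⇒m∸n<o (toℕ i) (toℕ j) (ℕₚ.<-≤-trans (Finₚ.toℕ<n i) k≤j+len))

    toℕ-offset : ∀ i → toℕ (offset i) ≡ toℕ i ∸ toℕ j
    toℕ-offset i = Finₚ.toℕ-fromℕ< _

    offset-mono : ∀ {i i′} → ¬ i Fin.< j → i Fin.< i′ → offset i Fin.< offset i′
    offset-mono {i} {i′} i≮j i<i′ =
      subst₂ ℕ._<_ (sym (toℕ-offset i)) (sym (toℕ-offset i′)) (ℕₚ.∸-monoˡ-< i<i′ (ℕₚ.≮⇒≥ i≮j))

  splice : Fin k → Fin n
  splice i with i Finₚ.<? j
  ... | yes _ = a i
  ... | no _ = c (offset i)

  splice-IsDecSubseq : IsDecSubseq π a → IsDecSubseq π c →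
                       (∀ i → i Fin.< j → (a i Fin.< c fzero) × (π (c fzero) Fin.< π (a i))) →
                       IsDecSubseq π splice
  splice-IsDecSubseq a-dec c-dec junction i i′ i<i′ with i Finₚ.<? j | i′ Finₚ.<? j
  ... | yes _ | yes _ = a-dec i i′ i<i′
  ... | yes i<j | no _ =
    ℕₚ.<-≤-trans (proj₁ (junction i i<j)) (proj₁ head≤) ,
    ℕₚ.≤-<-trans (proj₂ head≤) (proj₂ (junction i i<j))
    where head≤ = IsDecSubseq-≤ π c-dec {fzero} {offset i′} z≤n
  ... | no i≮j | yes i′<j = contradiction (ℕₚ.<-trans i<i′ i′<j) i≮j
  ... | no i≮j | no _ = c-dec _ _ (offset-mono i≮j i<i′)

  splice-LexLt : π (c fzero) Fin.< π (a j) → LexLt π splice a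
  splice-LexLt below =
    j , (λ i i<j → cong π (splice-below i i<j)) , subst (λ x → π x Fin.< π (a j)) (sym splice-at) below
    where
      splice-below : ∀ i → i Fin.< j → splice i ≡ a i
      splice-below i i<j with i Finₚ.<? j
      ... | yes _ = refl
      ... | no i≮j = contradiction i<j i≮j

      splice-at : splice j ≡ c fzero
      splice-at with j Finₚ.<? j
      ... | yes j<j = contradiction j<j (ℕₚ.<-irrefl refl)
      ... | no _ = cong c (Finₚ.toℕ-injective (trans (toℕ-offset j) (ℕₚ.n∸n≡0 (toℕ j))))

module ASeq {k n : ℕ} {π : Fin n → Fin n} {a : Fin k → Fin n} (aSeq : IsASeq k π a) where

  private
    a-dec : IsDecSubseq π a
    a-dec = proj₁ aSeq

    ∸≤⇒≤+ : ∀ (j : Fin k) {l} → k ∸ toℕ j ≤ l → k ≤ toℕ j + l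
    ∸≤⇒≤+ j k∸j≤l =
      subst (_≤ toℕ j + _) (ℕₚ.m+[n∸m]≡n (ℕₚ.<⇒≤ (Finₚ.toℕ<n j))) (ℕₚ.+-monoʳ-≤ (toℕ j) k∸j≤l)

  continuation-not-below : (j : Fin k) {m : ℕ} (c : Fin (suc m) → Fin n) → IsDecSubseq π c →
                           k ≤ toℕ j + suc m → (∀ i → i Fin.< j → a i Fin.< c fzero) →
                           ¬ π (c fzero) Fin.< π (a j)
  continuation-not-below j c c-dec k≤j+len after below =
    LexLt⇒¬LexLe π (splice-LexLt below) (proj₂ aSeq splice (splice-IsDecSubseq a-dec c-dec junction))
    where
      open Splice π a j c k≤j+len
      junction : ∀ i → i Fin.< j → (a i Fin.< c fzero) × (π (c fzero) Fin.< π (a i))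
      junction i i<j = after i i<j , ℕₚ.<-trans below (proj₂ (a-dec i j i<j))

  suffix-length : (j : Fin k) → k ∸ toℕ j ≡ suc (k ∸ suc (toℕ j))
  suffix-length j = ℕₚ.+-∸-assoc 1 (Finₚ.toℕ<n j)

  module Suffix (j : Fin k) where

    private
      shift : Fin (suc (k ∸ suc (toℕ j))) → Fin k
      shift i = fromℕ< (subst (ℕ._< k) (ℕₚ.+-comm (toℕ i) (toℕ j))
                  (ℕₚ.m≤o∸n⇒m+n≤o (suc (toℕ i)) (ℕₚ.<⇒≤ (Finₚ.toℕ<n j))
                    (subst (toℕ i ℕ.<_) (sym (suffix-length j)) (Finₚ.toℕ<n i))))

      toℕ-shift : ∀ i → toℕ (shift i) ≡ toℕ j + toℕ i
      toℕ-shift i = Finₚ.toℕ-fromℕ< _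

    suffix : Fin (suc (k ∸ suc (toℕ j))) → Fin n
    suffix = a ∘ shift

    suffix-IsDecSubseq : IsDecSubseq π suffix
    suffix-IsDecSubseq = IsDecSubseq-∘ π shift shift-mono a-dec
      where
        shift-mono : ∀ {i i′} → i Fin.< i′ → shift i Fin.< shift i′
        shift-mono {i} {i′} i<i′ =
          subst₂ ℕ._<_ (sym (toℕ-shift i)) (sym (toℕ-shift i′)) (ℕₚ.+-monoʳ-< (toℕ j) i<i′)

    suffix-head : suffix fzero ≡ a j
    suffix-head = cong a (Finₚ.toℕ-injective (trans (toℕ-shift fzero) (ℕₚ.+-identityʳ (toℕ j))))

  open Suffix

  label : (j : Fin k) → Label π (a j) (k ∸ toℕ j)
  label j = (_ , suffix-length j , suffix j , suffix-IsDecSubseq j , suffix-head j) , bounded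
    where
      not-longer : ∀ m (s : Fin (suc m) → Fin n) → IsDecSubseq π s → s fzero ≡ a j →
                   ¬ k ∸ toℕ j ℕ.< suc m
      not-longer zero _ _ _ k∸j<1 = ℕₚ.<⇒≱ k∸j<1 (subst (1 ℕ.≤_) (sym (suffix-length j)) (s≤s z≤n))
      not-longer (suc m) s s-dec s₀≡aj k∸j<len =
        continuation-not-below j (tail s) (IsDecSubseq-∘ π fsuc s≤s s-dec)
          (∸≤⇒≤+ j (ℕ.s≤s⁻¹ k∸j<len))
          (λ i i<j → ℕₚ.<-trans (subst (a i Fin.<_) (sym s₀≡aj) (proj₁ (a-dec i j i<j))) (proj₁ s₀>s₁))
          (subst (λ x → π (s (fsuc fzero)) Fin.< π x) s₀≡aj (proj₂ s₀>s₁))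
        where s₀>s₁ = s-dec fzero (fsuc fzero) (s≤s z≤n)

      bounded : ∀ m (s : Fin (suc m) → Fin n) → IsDecSubseq π s → s fzero ≡ a j → suc m ≤ k ∸ toℕ j
      bounded m s s-dec s₀≡aj = ℕₚ.≮⇒≥ (not-longer m s s-dec s₀≡aj)

  no-label-between : IsPerm π → (j : Fin k) (r : Fin n) → (∀ i → i Fin.< j → a i Fin.< r) →
                     r Fin.< a j → ¬ Label π r (k ∸ toℕ j)
  no-label-between perm j r after r<aj ((_ , len , c , c-dec , c₀≡r) , bounded)
    with Finₚ.<-cmp (π r) (π (a j))
  ... | tri< πr<πaj _ _ =
    continuation-not-below j c c-dec (∸≤⇒≤+ j (ℕₚ.≤-reflexive len))
      (λ i i<j → subst (a i Fin.<_) (sym c₀≡r) (after i i<j))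
      (subst (λ x → π x Fin.< π (a j)) (sym c₀≡r) πr<πaj)
  ... | tri≈ _ πr≡πaj _ = ℕₚ.<-irrefl (cong toℕ (perm πr≡πaj)) r<aj
  ... | tri> _ _ πaj<πr = ℕₚ.<-irrefl (sym (suffix-length j)) too-long
    where
      too-long : suc (suc (k ∸ suc (toℕ j))) ≤ k ∸ toℕ j
      too-long = bounded _ (r ∷ suffix j)
        (IsDecSubseq-∷ π (subst (r Fin.<_) (sym (suffix-head j)) r<aj)
                         (subst (λ x → π x Fin.< π r) (sym (suffix-head j)) πaj<πr)
                         (suffix-IsDecSubseq j))
        refl

  leftmost-label : IsPerm π → (j : Fin k) → toℕ j ≡ 0 → LeftmostWithLabel π (a j) k
  leftmost-label perm j j≡0 =
    label-k , λ r r<aj → no-label-between perm j r none r<aj ∘ subst (Label π r) (sym k∸j≡k)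
    where
      k∸j≡k : k ∸ toℕ j ≡ k
      k∸j≡k = cong (k ∸_) j≡0
      label-k : Label π (a j) k
      label-k = subst (Label π (a j)) k∸j≡k (label j)
      none : ∀ {r} i → i Fin.< j → a i Fin.< r
      none i i<j = contradiction (subst (toℕ i ℕ.<_) j≡0 i<j) ℕₚ.n≮0

  first-after-label : IsPerm π → (j : Fin k) → 1 ≤ toℕ j →
                      FirstAfterWithLabel π (a (predF j)) (a j) (k ∸ toℕ j)
  first-after-label perm (fsuc j) _ =
    proj₁ (a-dec (inject₁ j) (fsuc j) (Finₚ.≤̄⇒inject₁< ℕₚ.≤-refl)) ,
    label (fsuc j) ,
    λ r aj<r r<aj′ → no-label-between perm (fsuc j) r (before r aj<r) r<aj′
    where
      before : ∀ r → a (inject₁ j) Fin.< r → ∀ i → i Fin.< fsuc j → a i Fin.< r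
      before r aj<r i i<j′ = ℕₚ.≤-<-trans (proj₁ (IsDecSubseq-≤ π a-dec i≤j)) aj<r
        where
          i≤j : i Fin.≤ inject₁ j
          i≤j = subst (toℕ i ℕ.≤_) (sym (Finₚ.toℕ-inject₁ j)) (ℕ.s≤s⁻¹ i<j′)

lemma17 : (k n : ℕ) → 2 ≤ k → (π : Fin n → Fin n) → IsPerm π
    → (a : Fin k → Fin n) → IsASeq k π a
    → (∀ (j : Fin k) → toℕ j ≡ 0 → LeftmostWithLabel π (a j) k)
      × (∀ (j : Fin k) → 1 ≤ toℕ j → FirstAfterWithLabel π (a (predF j)) (a j) (k ∸ toℕ j))
      × (∀ (j : Fin k) → toℕ j ≡ 0 → IsSuccSeq π (a j) a)
      × (∀ (j : Fin k) → Label π (a j) (k ∸ toℕ j))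
lemma17 k n _ π perm a aSeq =
  leftmost-label perm ,
  first-after-label perm ,
  (λ j j≡0 → proj₁ (leftmost-label perm j j≡0) , same-head j j≡0 , first-after-label perm) ,
  label
  where
    open ASeq {π = π} aSeq
    same-head : ∀ j → toℕ j ≡ 0 → ∀ j′ → toℕ j′ ≡ 0 → a j′ ≡ a j
    same-head j j≡0 j′ j′≡0 = cong a (Finₚ.toℕ-injective (trans j′≡0 (sym j≡0)))
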